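{- Let $k$ be a positive integer and $m\ge 0$ an integer with $k\geq 5m+2$. Then $va_3^{\equiv}(K_{4k+2,4k+2,4k+2})\leq 3k-3m$.
   Context: All graphs are finite and simple. A $t$-coloring of a graph $G$ is a map $f:V(G)\to\{1,\dots,t\}$, with color classes $V_i=\{v: f(v)=i\}$. It is equitable if $\big||V_i|-|V_j|\big|\le 1$ for all $i,j$. A $(t,k)$-tree-coloring of $G$ is a $t$-coloring such that every connected component of each induced subgraph $G[V_i]$ is a tree of maximum degree at most $k$; an equitable $(t,k)$-tree-coloring is a $(t,k)$-tree-coloring that is equitable. The strong equitable vertex $k$-arboricity $va_k^{\equiv}(G)$ is the smallest integer $t$ such that $G$ has an equitable $(t',k)$-tree-coloring for every integer $t'\ge t$. $K_{n,n,n}$ denotes the complete tripartite graph whose three partite sets each have exactly $n$ vertices. -}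

module Defs where

open import Data.Nat using (ℕ; _+_; _*_; _≤_; _≥_)
open import Data.Fin using (Fin; quotient)
open import Data.Fin.Properties using (_≟_)
open import Data.Bool using (Bool; true; false; not)
open import Data.List using (List; []; _∷_; length; filter; allFin; last)
open import Data.List.Relation.Unary.All using (All)
open import Data.List.Relation.Unary.Unique.Propositional using (Unique)
open import Data.List.Relation.Unary.Linked using (Linked)
open import Data.Maybe using (just)
open import Data.Product using (_×_; Σ; ∃)
open import Data.Empty using (⊥; ⊥-elim)
open import Relation.Binary.PropositionalEquality using (_≡_; refl)
import Relation.Binary.PropositionalEquality as Eq
open import Relation.Nullary using (¬_; yes; no)
open import Relation.Nullary.Decidable using (⌊_⌋)

record Graph (N : ℕ) : Set where
  field
    adj   : Fin N → Fin N → Bool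
    sym   : ∀ u v → adj u v ≡ adj v u
    irrefl : ∀ v → adj v v ≡ false
open Graph public

-- A t-coloring: colors 1..t are represented by Fin t.
Coloring : ℕ → ℕ → Set
Coloring N t = Fin N → Fin t

classSize : ∀ {N t} → Coloring N t → Fin t → ℕ
classSize {N} f i = length (filter (λ v → f v ≟ i) (allFin N))

Equitable : ∀ {N t} → Coloring N t → Set
Equitable {t = t} f = ∀ (i j : Fin t) → classSize f i ≤ classSize f j + 1

classDegree : ∀ {N t} → Graph N → Coloring N t → Fin N → ℕ
classDegree {N} G f v =
  length (filter (λ u → f u ≟ f v) (filter (λ u → adj G v u Data.Bool.≟ true) (allFin N)))

Adj : ∀ {N} → Graph N → Fin N → Fin N → Set
Adj G u v = adj G u v ≡ true

IsCycleIn : ∀ {N t} → Graph N → Coloring N t → Fin t → List (Fin N) → Set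
IsCycleIn G f i [] = ⊥
IsCycleIn G f i (v ∷ vs) =
  3 ≤ length (v ∷ vs) × Unique (v ∷ vs) × All (λ u → f u ≡ i) (v ∷ vs)
  × Linked (Adj G) (v ∷ vs)
  × Σ (Fin _) (λ w → (last (v ∷ vs) ≡ just w) × Adj G w v)

-- (t,k)-tree-coloring: each component of each G[V_i] is a tree of max degree ≤ k,
-- i.e. each G[V_i] is acyclic (a forest) and has maximum degree ≤ k.
IsTreeColoring : ∀ {N t} → Graph N → ℕ → Coloring N t → Set
IsTreeColoring {N} {t} G k f =
  (∀ (i : Fin t) (c : List (Fin N)) → ¬ IsCycleIn G f i c)
  × (∀ (v : Fin N) → classDegree G f v ≤ k)

HasEquitableTreeColoring : ∀ {N} → Graph N → ℕ → ℕ → Set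
HasEquitableTreeColoring {N} G t k =
  ∃ λ (f : Coloring N t) → Equitable f × IsTreeColoring G k f

StrongEquitableThreshold : ∀ {N} → Graph N → ℕ → ℕ → Set
StrongEquitableThreshold G k t = ∀ t' → t' ≥ t → HasEquitableTreeColoring G t' k

-- va_k^≡(G) ≤ T  (va_k^≡ is the least threshold, so this holds iff some threshold is ≤ T)
StrongEquitableVertexArboricity≤ : ∀ {N} → Graph N → ℕ → ℕ → Set
StrongEquitableVertexArboricity≤ G k T = ∃ λ t → t ≤ T × StrongEquitableThreshold G k t

partK : ∀ n → Fin (3 * n) → Fin 3
partK n v = quotient n v

adjK : ∀ n → Fin (3 * n) → Fin (3 * n) → Bool
adjK n u v = not ⌊ partK n u ≟ partK n v ⌋

private
  adjK-sym : ∀ n u v → adjK n u v ≡ adjK n v u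
  adjK-sym n u v with partK n u ≟ partK n v | partK n v ≟ partK n u
  ... | yes _ | yes _ = refl
  ... | no _  | no _  = refl
  ... | yes p | no q  = ⊥-elim (q (Eq.sym p))
  ... | no p  | yes q = ⊥-elim (p (Eq.sym q))

  adjK-irrefl : ∀ n v → adjK n v v ≡ false
  adjK-irrefl n v with partK n v ≟ partK n v
  ... | yes _ = refl
  ... | no p  = ⊥-elim (p refl)

completeTripartite : (n : ℕ) → Graph (3 * n)
completeTripartite n = record { adj = adjK n ; sym = adjK-sym n ; irrefl = adjK-irrefl n }

module Submission where

-- Order the vertices of K_{n,n,n} part by part and color them by consecutive blocks whose
-- sizes differ by at most one.  A block inside one part is independent, and a block of at
-- most four vertices all but one of which lie in the same part induces a star with at most
-- three leaves; both are forests of maximum degree at most 3.  For n = 4k + 2 and t colors: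
-- if 3k - 3m ≤ t ≤ 3k, cut every part separately into about t/3 blocks of sizes 4 and 5, which
-- is possible because k ≥ 5m + 2 gives n ≤ 5(k - m); if t = 3k + 1, use two 4-blocks as stars
-- across the part boundaries; if 3k + 2 ≤ t ≤ n, the blocks have sizes 3 and 4 and two
-- 3-blocks straddle the boundaries; if t > n, no block has more than three vertices and any
-- order works.

open import Defs hiding (sym)
open import Data.Nat using (ℕ; zero; suc; _+_; _*_; _∸_; _≤_; _≥_; _<_; z≤n; s≤s; s≤s⁻¹; _<?_; _≤?_)
open import Data.Nat.Properties
open import Data.Nat.DivMod using (_/_; _%_; m≡m%n+[m/n]*n; m%n<n; m/n*n≤m; m<n*o⇒m/o<n; m/n≡1+[m∸n]/n)
open import Data.Nat.Tactic.RingSolver using (solve-∀)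
open import Algebra.Properties.CommutativeSemigroup +-commutativeSemigroup using (xy∙z≈xz∙y)
open import Data.Bool using (true)
import Data.Bool.Properties as Bool
open import Data.Fin using (Fin; toℕ; fromℕ<; quotient; remQuot) renaming (zero to fzero; suc to fsuc)
import Data.Fin.Properties as Fin
open import Data.List using (List; []; _∷_; length; filter; tabulate; allFin; last; _++_; replicate)
open import Data.List.Properties using (filter-accept; filter-reject; filter-notAll; filter-none; length-++; length-replicate)
open import Data.Nat.ListAction using (sum)
open import Data.Nat.ListAction.Properties using (sum-++; sum-↭)
open import Data.List.Relation.Unary.All as All using (All; []; _∷_)
import Data.List.Relation.Unary.All.Properties as All
open import Data.List.Relation.Unary.Any as Any using ()
open import Data.List.Relation.Unary.AllPairs using (_∷_)
open import Data.List.Relation.Unary.Linked using (Linked; _∷_)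
open import Data.List.Membership.Propositional.Properties using (∈-allFin; ∈-filter⁺)
open import Data.List.Relation.Binary.Permutation.Propositional using (_↭_; prep; ↭-sym; module PermutationReasoning)
open import Data.List.Relation.Binary.Permutation.Propositional.Properties using (shift; ++⁺ˡ; ↭-length; All-resp-↭)
open import Data.Maybe using (just)
open import Data.Product using (_×_; ∃-syntax; _,_; proj₁; proj₂)
open import Data.Sum using (_⊎_; inj₁; inj₂)
open import Data.Unit using (⊤; tt)
open import Data.Empty using (⊥; ⊥-elim)
open import Function using (_∘_; id; case_of_)
open import Relation.Binary.PropositionalEquality
open import Relation.Nullary using (¬_; yes; no)
open import Relation.Unary using (Decidable)

module _ {A : Set} {P Q : A → Set} (P? : Decidable P) (Q? : Decidable Q) where

  filter-comm : ∀ xs → filter P? (filter Q? xs) ≡ filter Q? (filter P? xs)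
  filter-comm []       = refl
  filter-comm (x ∷ xs) with P? x | Q? x
  ... | yes p | yes q = trans (filter-accept P? p) (trans (cong (x ∷_) (filter-comm xs)) (sym (filter-accept Q? q)))
  ... | yes _ | no ¬q = trans (filter-comm xs) (sym (filter-reject Q? ¬q))
  ... | no ¬p | yes _ = trans (filter-reject P? ¬p) (filter-comm xs)
  ... | no _  | no _  = filter-comm xs

module _ {N t : ℕ} (G : Graph N) (f : Coloring N t) where

  private
    sameColor? : ∀ v → Decidable (λ u → f u ≡ f v)
    sameColor? v u = f u Fin.≟ f v

    adjacent? : ∀ v → Decidable (λ u → adj G v u ≡ true)
    adjacent? v u = adj G v u Bool.≟ true

  classDegree<classSize : ∀ v → classDegree G f v < classSize f (f v)
  classDegree<classSize v =
    subst (_< classSize f (f v)) (cong length (filter-comm (adjacent? v) (sameColor? v) (allFin N)))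
      (filter-notAll (adjacent? v) _
        (Any.map (λ { refl loop → case trans (sym loop) (irrefl G v) of λ () })
          (∈-filter⁺ (sameColor? v) (∈-allFin v) refl)))

  classDegree≡0 : ∀ v → (∀ u → f u ≡ f v → ¬ Adj G v u) → classDegree G f v ≡ 0
  classDegree≡0 v independent =
    cong length (filter-none (sameColor? v) (All.map (λ {u} vu same → independent u same vu)
      (All.all-filter (adjacent? v) (allFin N))))

  acyclic-star : ∀ i c → (∀ u w → f u ≡ i → f w ≡ i → Adj G u w → toℕ u ≡ c ⊎ toℕ w ≡ c) →
                 ∀ cs → ¬ IsCycleIn G f i cs
  acyclic-star i c star []                ()
  acyclic-star i c star (_ ∷ [])          (s≤s () , _)
  acyclic-star i c star (_ ∷ _ ∷ [])      (s≤s (s≤s ()) , _)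
  acyclic-star i c star (v₀ ∷ v₁ ∷ v₂ ∷ vs)
    (_ , ((v₀≢v₁ ∷ v₀≢v₂ ∷ _) ∷ (v₁≢v₂ ∷ v₁∉vs) ∷ _) , (i₀ ∷ i₁ ∷ i₂ ∷ is) , (e₀₁ ∷ e₁₂ ∷ es) , w , last≡w , ew₀)
    with star v₀ v₁ i₀ i₁ e₀₁ | star v₁ v₂ i₁ i₂ e₁₂
  ... | inj₁ p    | inj₁ q = v₀≢v₁ (Fin.toℕ-injective (trans p (sym q)))
  ... | inj₁ p    | inj₂ q = v₀≢v₂ (Fin.toℕ-injective (trans p (sym q)))
  ... | inj₂ p    | inj₂ q = v₁≢v₂ (Fin.toℕ-injective (trans p (sym q)))
  ... | inj₂ v₁≡c | inj₁ _ = nextEdge vs v₁∉vs is es last≡w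
    where
    -- v₁ is the center, but the edge after v₂ (to v₃, or back to v₀) avoids it
    nextEdge : ∀ vs → All (v₁ ≢_) vs → All (λ u → f u ≡ i) vs → Linked (Adj G) (v₂ ∷ vs) →
               last (v₀ ∷ v₁ ∷ v₂ ∷ vs) ≡ just w → ⊥
    nextEdge [] _ _ _ refl with star v₂ v₀ i₂ i₀ ew₀
    ... | inj₁ q = v₁≢v₂ (Fin.toℕ-injective (trans v₁≡c (sym q)))
    ... | inj₂ q = v₀≢v₁ (Fin.toℕ-injective (trans q (sym v₁≡c)))
    nextEdge (v₃ ∷ _) (v₁≢v₃ ∷ _) (i₃ ∷ _) (e₂₃ ∷ _) _ with star v₂ v₃ i₂ i₃ e₂₃
    ... | inj₁ q = v₁≢v₂ (Fin.toℕ-injective (trans v₁≡c (sym q)))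
    ... | inj₂ q = v₁≢v₃ (Fin.toℕ-injective (trans v₁≡c (sym q)))

-- Blocks of consecutive positions

-- L lists the sizes of consecutive blocks of 0, 1, 2, …; block j occupies the positions
-- blockStart L j, …, blockStart L j + blockSize L j - 1 (blockSize is 0 past the end of L).
blockOf : List ℕ → ℕ → ℕ
blockOf []      p = 0
blockOf (b ∷ L) p with p <? b
... | yes _ = 0
... | no  _ = suc (blockOf L (p ∸ b))

blockStart : List ℕ → ℕ → ℕ
blockStart []      _       = 0
blockStart (b ∷ L) zero    = 0
blockStart (b ∷ L) (suc j) = b + blockStart L j

blockSize : List ℕ → ℕ → ℕ
blockSize []      _       = 0
blockSize (b ∷ L) zero    = b
blockSize (b ∷ L) (suc j) = blockSize L j

record InBlock (S b p : ℕ) : Set where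
  constructor _,_
  field
    lower : S ≤ p
    upper : p < S + b

blockOf-head : ∀ {b p} L → p < b → blockOf (b ∷ L) p ≡ 0
blockOf-head {b} {p} L p<b with p <? b
... | yes _   = refl
... | no  p≮b = ⊥-elim (p≮b p<b)

blockOf-tail : ∀ b L p → blockOf (b ∷ L) (b + p) ≡ suc (blockOf L p)
blockOf-tail b L p with b + p <? b
... | yes b+p<b = ⊥-elim (m+n≮m b p b+p<b)
... | no  _     = cong (suc ∘ blockOf L) (m+n∸m≡n b p)

blockOf-< : ∀ L {p} → p < sum L → blockOf L p < length L
blockOf-< (b ∷ L) {p} p<b+L with p <? b
... | yes _   = s≤s z≤n
... | no  p≮b = s≤s (blockOf-< L (+-cancelˡ-< b (p ∸ b) (sum L)
                  (subst (_< b + sum L) (sym (m+[n∸m]≡n (≮⇒≥ p≮b))) p<b+L)))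

blockOf-inBlock : ∀ L p → blockOf L p < length L → InBlock (blockStart L (blockOf L p)) (blockSize L (blockOf L p)) p
blockOf-inBlock (b ∷ L) p j<len with p <? b
... | yes p<b = z≤n , p<b
... | no  p≮b with lower , upper ← blockOf-inBlock L (p ∸ b) (s≤s⁻¹ j<len) = b+S≤p , p<b+S+z
  where
  open ≤-Reasoning
  j = blockOf L (p ∸ b)
  b+[p∸b]≡p = m+[n∸m]≡n (≮⇒≥ p≮b)
  b+S≤p : b + blockStart L j ≤ p
  b+S≤p = begin
    b + blockStart L j ≤⟨ +-monoʳ-≤ b lower ⟩
    b + (p ∸ b)        ≡⟨ b+[p∸b]≡p ⟩
    p                  ∎
  p<b+S+z : p < b + blockStart L j + blockSize L j
  p<b+S+z = begin-strict
    p                                    ≡⟨ b+[p∸b]≡p ⟨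
    b + (p ∸ b)                          <⟨ +-monoʳ-< b upper ⟩
    b + (blockStart L j + blockSize L j) ≡⟨ +-assoc b _ _ ⟨
    b + blockStart L j + blockSize L j   ∎

All-blockSize : ∀ {P : ℕ → Set} {L j} → All P L → j < length L → P (blockSize L j)
All-blockSize {j = zero}  (p ∷ _)  _        = p
All-blockSize {j = suc j} (_ ∷ ps) (s≤s j<) = All-blockSize ps j<

preimageSize : (ℕ → ℕ) → ℕ → ℕ → ℕ
preimageSize g j zero    = 0
preimageSize g j (suc N) with g 0 ≟ j
... | yes _ = suc (preimageSize (g ∘ suc) j N)
... | no  _ = preimageSize (g ∘ suc) j N

preimageSize-+ : ∀ g j a b → preimageSize g j (a + b) ≡ preimageSize g j a + preimageSize (λ p → g (a + p)) j b
preimageSize-+ g j zero    b = refl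
preimageSize-+ g j (suc a) b with g 0 ≟ j
... | yes _ = cong suc (preimageSize-+ (g ∘ suc) j a b)
... | no  _ = preimageSize-+ (g ∘ suc) j a b

preimageSize-cong : ∀ {g h} j N → (∀ p → g p ≡ h p) → preimageSize g j N ≡ preimageSize h j N
preimageSize-cong {g} {h} j zero    g≗h = refl
preimageSize-cong {g} {h} j (suc N) g≗h with g 0 ≟ j | h 0 ≟ j
... | yes _  | yes _  = cong suc (preimageSize-cong j N (g≗h ∘ suc))
... | no  _  | no  _  = preimageSize-cong j N (g≗h ∘ suc)
... | yes eq | no  ne = ⊥-elim (ne (trans (sym (g≗h 0)) eq))
... | no  ne | yes eq = ⊥-elim (ne (trans (g≗h 0) eq))

preimageSize-all : ∀ g j N → (∀ p → p < N → g p ≡ j) → preimageSize g j N ≡ N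
preimageSize-all g j zero    _   = refl
preimageSize-all g j (suc N) all with g 0 ≟ j
... | yes _ = cong suc (preimageSize-all (g ∘ suc) j N (λ p → all (suc p) ∘ s≤s))
... | no ne = ⊥-elim (ne (all 0 (s≤s z≤n)))

preimageSize-none : ∀ g j N → (∀ p → p < N → g p ≢ j) → preimageSize g j N ≡ 0
preimageSize-none g j zero    _    = refl
preimageSize-none g j (suc N) none with g 0 ≟ j
... | yes eq = ⊥-elim (none 0 (s≤s z≤n) eq)
... | no  _  = preimageSize-none (g ∘ suc) j N (λ p → none (suc p) ∘ s≤s)

preimageSize-suc : ∀ g j N → preimageSize (suc ∘ g) (suc j) N ≡ preimageSize g j N
preimageSize-suc g j zero    = refl
preimageSize-suc g j (suc N) with suc (g 0) ≟ suc j | g 0 ≟ j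
... | yes _  | yes _  = cong suc (preimageSize-suc (g ∘ suc) j N)
... | no  _  | no  _  = preimageSize-suc (g ∘ suc) j N
... | yes eq | no  ne = ⊥-elim (ne (suc-injective eq))
... | no  ne | yes eq = ⊥-elim (ne (cong suc eq))

preimageSize-blockOf : ∀ L j → preimageSize (blockOf L) j (sum L) ≡ blockSize L j
preimageSize-blockOf []      j = refl
preimageSize-blockOf (b ∷ L) j = begin
  preimageSize (blockOf (b ∷ L)) j (b + sum L)
    ≡⟨ preimageSize-+ (blockOf (b ∷ L)) j b (sum L) ⟩
  preimageSize (blockOf (b ∷ L)) j b + preimageSize (λ p → blockOf (b ∷ L) (b + p)) j (sum L)
    ≡⟨ cong (preimageSize (blockOf (b ∷ L)) j b +_) (preimageSize-cong j (sum L) (blockOf-tail b L)) ⟩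
  preimageSize (blockOf (b ∷ L)) j b + preimageSize (suc ∘ blockOf L) j (sum L)
    ≡⟨ byBlock j ⟩
  blockSize (b ∷ L) j ∎
  where
  open ≡-Reasoning
  inHead : ∀ p → p < b → blockOf (b ∷ L) p ≡ 0
  inHead p = blockOf-head L
  byBlock : ∀ j → preimageSize (blockOf (b ∷ L)) j b + preimageSize (suc ∘ blockOf L) j (sum L) ≡ blockSize (b ∷ L) j
  byBlock zero    = trans (cong₂ _+_ (preimageSize-all _ 0 b inHead) (preimageSize-none _ 0 (sum L) (λ _ _ ())))
                          (+-identityʳ b)
  byBlock (suc j) = trans (cong₂ _+_ (preimageSize-none _ (suc j) b (λ p p<b → 0≢1+n ∘ trans (sym (inHead p p<b))))
                                     (preimageSize-suc (blockOf L) j (sum L)))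
                          (preimageSize-blockOf L j)

classSize-preimageSize : ∀ {N t} (f : Coloring N t) g → (∀ v → toℕ (f v) ≡ g (toℕ v)) →
                         ∀ i → classSize f i ≡ preimageSize g (toℕ i) N
classSize-preimageSize f g f≈g i = onTabulate id g f≈g
  where
  onTabulate : ∀ {N} (e : Fin N → Fin _) g → (∀ v → toℕ (f (e v)) ≡ g (toℕ v)) →
               length (filter (λ v → f v Fin.≟ i) (tabulate e)) ≡ preimageSize g (toℕ i) N
  onTabulate {zero}  e g f≈g = refl
  onTabulate {suc N} e g f≈g with f (e fzero) Fin.≟ i | g 0 ≟ toℕ i
  ... | yes _  | yes _  = cong suc (onTabulate (e ∘ fsuc) (g ∘ suc) (f≈g ∘ fsuc))
  ... | no  _  | no  _  = onTabulate (e ∘ fsuc) (g ∘ suc) (f≈g ∘ fsuc)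
  ... | yes eq | no  ne = ⊥-elim (ne (trans (sym (f≈g fzero)) (cong toℕ eq)))
  ... | no  ne | yes eq = ⊥-elim (ne (Fin.toℕ-injective (trans (f≈g fzero) eq)))

blockColoring : ∀ {N} (L : List ℕ) → sum L ≡ N → Coloring N (length L)
blockColoring L sum≡N v = fromℕ< (blockOf-< L (subst (toℕ v <_) (sym sum≡N) (Fin.toℕ<n v)))

module _ {N} (L : List ℕ) (sum≡N : sum L ≡ N) where

  private
    f = blockColoring L sum≡N

  toℕ-blockColoring : ∀ v → toℕ (f v) ≡ blockOf L (toℕ v)
  toℕ-blockColoring v = Fin.toℕ-fromℕ< _

  classSize-blockColoring : ∀ i → classSize f i ≡ blockSize L (toℕ i)
  classSize-blockColoring i = begin
    classSize f i                            ≡⟨ classSize-preimageSize f (blockOf L) toℕ-blockColoring i ⟩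
    preimageSize (blockOf L) (toℕ i) N       ≡⟨ cong (preimageSize (blockOf L) (toℕ i)) sum≡N ⟨
    preimageSize (blockOf L) (toℕ i) (sum L) ≡⟨ preimageSize-blockOf L (toℕ i) ⟩
    blockSize L (toℕ i)                      ∎
    where open ≡-Reasoning

  blockColoring-inBlock : ∀ {v i} → f v ≡ i → InBlock (blockStart L (toℕ i)) (blockSize L (toℕ i)) (toℕ v)
  blockColoring-inBlock {v} refl rewrite toℕ-blockColoring v =
    blockOf-inBlock L (toℕ v) (blockOf-< L (subst (toℕ v <_) (sym sum≡N) (Fin.toℕ<n v)))

-- Blocks of vertices of K_{n,n,n}

K : (n : ℕ) → Graph (3 * n)
K = completeTripartite

record InPart (n a p : ℕ) : Set where
  constructor _,_
  field
    lower : a * n ≤ p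
    upper : p < suc a * n

quotient-unique : ∀ n {q r a} → r < n → a * n ≤ n * q + r → n * q + r < suc a * n → q ≡ a
quotient-unique n {q} {r} {a} r<n lo hi = ≤-antisym (s≤s⁻¹ q<1+a) (s≤s⁻¹ a<1+q)
  where
  open ≤-Reasoning
  q<1+a : q < suc a
  q<1+a = *-cancelʳ-< n q (suc a) (begin-strict
    q * n     ≡⟨ *-comm q n ⟩
    n * q     ≤⟨ m≤m+n (n * q) r ⟩
    n * q + r <⟨ hi ⟩
    suc a * n ∎)
  a<1+q : a < suc q
  a<1+q = *-cancelʳ-< n a (suc q) (begin-strict
    a * n     ≤⟨ lo ⟩
    n * q + r <⟨ +-monoʳ-< (n * q) r<n ⟩
    n * q + n ≡⟨ +-comm (n * q) n ⟩
    n + n * q ≡⟨ cong (n +_) (*-comm n q) ⟩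
    suc q * n ∎)

toℕ-partK : ∀ n {a} v → InPart n a (toℕ v) → toℕ (partK n v) ≡ a
toℕ-partK n {a} v (lo , hi) =
  quotient-unique n (Fin.toℕ<n r) (subst (a * n ≤_) v≡ lo) (subst (_< suc a * n) v≡ hi)
  where
  q = quotient {3} n v
  r = proj₂ (remQuot {3} n v)
  v≡ : toℕ v ≡ n * toℕ q + toℕ r
  v≡ = trans (cong toℕ (sym (Fin.combine-remQuot {3} n v))) (Fin.toℕ-combine q r)

inPart⇒¬Adj : ∀ {n a u w} → InPart n a (toℕ u) → InPart n a (toℕ w) → ¬ Adj (K n) u w
inPart⇒¬Adj {n} {a} {u} {w} u∈a w∈a uw with partK n u Fin.≟ partK n w
... | no  u≢w = u≢w (Fin.toℕ-injective (trans (toℕ-partK n u u∈a) (sym (toℕ-partK n w w∈a))))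
... | yes _ with () ← uw

-- The positions S, …, S + b - 1 of the vertex order induce an independent set or a star
-- with at most three leaves.
data GoodBlock (n S b : ℕ) : Set where
  inPart : ∀ a → a * n ≤ S → S + b ≤ suc a * n → GoodBlock n S b
  star   : b ≤ 4 → ∀ c a → (∀ p → S ≤ p → p < S + b → p ≢ c → InPart n a p) → GoodBlock n S b

GoodBlocks : ℕ → ℕ → List ℕ → Set
GoodBlocks n S []      = ⊤
GoodBlocks n S (b ∷ L) = GoodBlock n S b × GoodBlocks n (S + b) L

GoodBlocks⇒GoodBlock : ∀ {n S} L {j} → GoodBlocks n S L → j < length L →
                       GoodBlock n (S + blockStart L j) (blockSize L j)
GoodBlocks⇒GoodBlock {n} {S} (b ∷ L) {zero}  (good , _)  _        =
  subst (λ x → GoodBlock n x b) (sym (+-identityʳ S)) good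
GoodBlocks⇒GoodBlock {n} {S} (b ∷ L) {suc j} (_ , goods) (s≤s j<) =
  subst (λ x → GoodBlock n x (blockSize L j)) (+-assoc S b _) (GoodBlocks⇒GoodBlock L goods j<)

inBlock⇒inPart : ∀ {n a S b p} → a * n ≤ S → S + b ≤ suc a * n → InBlock S b p → InPart n a p
inBlock⇒inPart an≤S S+b≤ (S≤p , p<S+b) = ≤-trans an≤S S≤p , <-≤-trans p<S+b S+b≤

goodBlock-center : ∀ {n S b} → GoodBlock n S b → ∃[ c ] ∀ u w →
                   InBlock S b (toℕ u) → InBlock S b (toℕ w) → Adj (K n) u w → toℕ u ≡ c ⊎ toℕ w ≡ c
goodBlock-center {n} (inPart a lo hi) =
  0 , λ u w u∈ w∈ uw → ⊥-elim (inPart⇒¬Adj {n} {a} (inBlock⇒inPart lo hi u∈) (inBlock⇒inPart lo hi w∈) uw)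
goodBlock-center {n} {S} {b} (star _ c a leaves) = c , edge
  where
  edge : ∀ u w → InBlock S b (toℕ u) → InBlock S b (toℕ w) → Adj (K n) u w → toℕ u ≡ c ⊎ toℕ w ≡ c
  edge u w (Su , uS) (Sw , wS) uw with toℕ u ≟ c | toℕ w ≟ c
  ... | yes u≡c | _       = inj₁ u≡c
  ... | no  _   | yes w≡c = inj₂ w≡c
  ... | no  u≢c | no  w≢c = ⊥-elim (inPart⇒¬Adj (leaves _ Su uS u≢c) (leaves _ Sw wS w≢c) uw)

Balanced : ℕ → ℕ → Set
Balanced s b = s ≤ b × b ≤ suc s

goodBlocks⇒equitableTreeColoring : ∀ {n s} L → sum L ≡ 3 * n → All (Balanced s) L →
  GoodBlocks n 0 L → HasEquitableTreeColoring (K n) (length L) 3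
goodBlocks⇒equitableTreeColoring {n} {s} L sum≡ balanced good = f , equitable , acyclic , degree≤3
  where
  f = blockColoring L sum≡
  G = K n

  block : ∀ i → GoodBlock n (blockStart L (toℕ i)) (blockSize L (toℕ i))
  block i = GoodBlocks⇒GoodBlock L good (Fin.toℕ<n i)

  equitable : Equitable f
  equitable i j = begin
    classSize f i           ≡⟨ classSize-blockColoring L sum≡ i ⟩
    blockSize L (toℕ i)     ≤⟨ proj₂ (All-blockSize balanced (Fin.toℕ<n i)) ⟩
    suc s                   ≡⟨ +-comm 1 s ⟩
    s + 1                   ≤⟨ +-monoˡ-≤ 1 (proj₁ (All-blockSize balanced (Fin.toℕ<n j))) ⟩
    blockSize L (toℕ j) + 1 ≡⟨ cong (_+ 1) (classSize-blockColoring L sum≡ j) ⟨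
    classSize f j + 1       ∎
    where open ≤-Reasoning

  acyclic : ∀ i cs → ¬ IsCycleIn G f i cs
  acyclic i with c , edge ← goodBlock-center (block i) =
    acyclic-star G f i c λ u w fu≡i fw≡i →
      edge u w (blockColoring-inBlock L sum≡ fu≡i) (blockColoring-inBlock L sum≡ fw≡i)

  degree≤3 : ∀ v → classDegree G f v ≤ 3
  degree≤3 v with block (f v)
  ... | inPart a lo hi = subst (_≤ 3) (sym (classDegree≡0 G f v independent)) z≤n
    where
    inPart-a : ∀ {u} → f u ≡ f v → InPart n a (toℕ u)
    inPart-a = inBlock⇒inPart lo hi ∘ blockColoring-inBlock L sum≡
    independent : ∀ u → f u ≡ f v → ¬ Adj G v u
    independent u fu≡fv = inPart⇒¬Adj (inPart-a refl) (inPart-a fu≡fv)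
  ... | star size≤4 _ _ _ = s≤s⁻¹ (begin-strict
    classDegree G f v       <⟨ classDegree<classSize G f v ⟩
    classSize f (f v)       ≡⟨ classSize-blockColoring L sum≡ (f v) ⟩
    blockSize L (toℕ (f v)) ≤⟨ size≤4 ⟩
    4                       ∎)
    where open ≤-Reasoning

leadingStar : ∀ {n S b} a → suc S ≡ a * n → S + b ≤ suc a * n → b ≤ 4 → GoodBlock n S b
leadingStar {S = S} a 1+S≡an S+b≤ b≤4 =
  star b≤4 S a λ p S≤p p<S+b p≢S → subst (_≤ p) 1+S≡an (≤∧≢⇒< S≤p (p≢S ∘ sym)) , <-≤-trans p<S+b S+b≤

trailingStar : ∀ {n S b} a → a * n ≤ S → S + b ≡ suc (suc a * n) → b ≤ 4 → GoodBlock n S b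
trailingStar {n} a an≤S S+b≡ b≤4 =
  star b≤4 (suc a * n) a λ p S≤p p<S+b p≢c → ≤-trans an≤S S≤p , ≤∧≢⇒< (s≤s⁻¹ (subst (p <_) S+b≡ p<S+b)) p≢c

GoodBlock-≤3 : ∀ {n b} S → 2 ≤ n → b ≤ 3 → GoodBlock n S b
GoodBlock-≤3 {n@(suc _)} {b} S 2≤n b≤3 with d , r+d≡n ← m≤n⇒∃[o]m+o≡n (<⇒≤ (m%n<n S n)) = byGap d r+d≡n
  where
  open ≤-Reasoning
  r = S % n
  Q = S / n * n
  S≡r+Q : S ≡ r + Q
  S≡r+Q = m≡m%n+[m/n]*n S n
  Q≤S : Q ≤ S
  Q≤S = subst (Q ≤_) (sym S≡r+Q) (m≤n+m Q r)
  -- d is the distance from S to the end of its part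
  byGap : ∀ d → r + d ≡ n → GoodBlock n S b
  byGap d r+d≡n with b ≤? d
  ... | yes b≤d = inPart (S / n) Q≤S (begin
    S + b     ≡⟨ cong (_+ b) S≡r+Q ⟩
    r + Q + b ≤⟨ +-monoʳ-≤ (r + Q) b≤d ⟩
    r + Q + d ≡⟨ xy∙z≈xz∙y r Q d ⟩
    r + d + Q ≡⟨ cong (_+ Q) r+d≡n ⟩
    n + Q     ∎)
  byGap 0 r+0≡n | no _ = ⊥-elim (<⇒≢ (m%n<n S n) (trans (sym (+-identityʳ r)) r+0≡n))
  byGap 1 r+1≡n | no _ =
    leadingStar (suc (S / n)) (trans (cong suc S≡r+Q) (cong (_+ Q) (trans (+-comm 1 r) r+1≡n))) (begin
      S + b           ≤⟨ +-monoʳ-≤ S b≤3 ⟩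
      S + 3           ≡⟨ cong (_+ 3) S≡r+Q ⟩
      r + Q + 3       ≡⟨ regroup r Q ⟩
      r + 1 + (2 + Q) ≡⟨ cong (_+ (2 + Q)) r+1≡n ⟩
      n + (2 + Q)     ≤⟨ +-monoʳ-≤ n (+-monoˡ-≤ Q 2≤n) ⟩
      n + (n + Q)     ∎)
    (≤-trans b≤3 (n≤1+n 3))
    where
    regroup : ∀ r Q → r + Q + 3 ≡ r + 1 + (2 + Q)
    regroup = solve-∀
  byGap 2 r+2≡n | no b≰2 = trailingStar (S / n) Q≤S S+b≡ (≤-trans b≤3 (n≤1+n 3))
    where
    regroup : ∀ r Q → r + Q + 3 ≡ suc (r + 2 + Q)
    regroup = solve-∀
    S+b≡ : S + b ≡ suc (n + Q)
    S+b≡ = begin-equality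
      S + b              ≡⟨ cong (S +_) (≤-antisym b≤3 (≰⇒> b≰2)) ⟩
      S + 3              ≡⟨ cong (_+ 3) S≡r+Q ⟩
      r + Q + 3          ≡⟨ regroup r Q ⟩
      suc (r + 2 + Q)    ≡⟨ cong (λ x → suc (x + Q)) r+2≡n ⟩
      suc (n + Q)        ∎
  byGap (suc (suc (suc d))) _ | no b≰3+d = ⊥-elim (b≰3+d (≤-trans b≤3 (m≤m+n 3 d)))

GoodBlocks-++ : ∀ {n S} L₁ {L₂} → GoodBlocks n S L₁ → GoodBlocks n (S + sum L₁) L₂ → GoodBlocks n S (L₁ ++ L₂)
GoodBlocks-++ {n} {S} []       {L₂} _              good₂ = subst (λ x → GoodBlocks n x L₂) (+-identityʳ S) good₂
GoodBlocks-++ {n} {S} (b ∷ L₁) {L₂} (good , good₁) good₂ =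
  good , GoodBlocks-++ L₁ good₁ (subst (λ x → GoodBlocks n x L₂) (sym (+-assoc S b (sum L₁))) good₂)

GoodBlocks-inPart : ∀ {n S} a L → a * n ≤ S → S + sum L ≤ suc a * n → GoodBlocks n S L
GoodBlocks-inPart         a []      _    _    = tt
GoodBlocks-inPart {n} {S} a (b ∷ L) an≤S end≤ =
  inPart a an≤S (≤-trans (+-monoʳ-≤ S (m≤m+n b (sum L))) end≤) ,
  GoodBlocks-inPart a L (≤-trans an≤S (m≤m+n S b)) (subst (_≤ suc a * n) (sym (+-assoc S b (sum L))) end≤)

GoodBlocks-≤3 : ∀ {n} S L → 2 ≤ n → All (_≤ 3) L → GoodBlocks n S L
GoodBlocks-≤3 S []      _   []          = tt
GoodBlocks-≤3 S (b ∷ L) 2≤n (b≤3 ∷ L≤3) = GoodBlock-≤3 S 2≤n b≤3 , GoodBlocks-≤3 (S + b) L 2≤n L≤3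

GoodBlocks-partwise : ∀ {n} L₁ L₂ L₃ → sum L₁ ≡ n → sum L₂ ≡ n → sum L₃ ≡ n → GoodBlocks n 0 (L₁ ++ L₂ ++ L₃)
GoodBlocks-partwise {n} L₁ L₂ L₃ refl sum₂ sum₃ =
  GoodBlocks-++ L₁ (GoodBlocks-inPart 0 L₁ z≤n (≤-reflexive (sym (*-identityˡ n))))
    (GoodBlocks-++ L₂ (GoodBlocks-inPart 1 L₂ (≤-reflexive (*-identityˡ n)) (≤-reflexive n+L₂≡2n))
      (GoodBlocks-inPart 2 L₃ (≤-reflexive (sym n+L₂≡2n)) (≤-reflexive n+L₂+L₃≡3n)))
  where
  n+L₂≡2n : n + sum L₂ ≡ 2 * n
  n+L₂≡2n = cong (n +_) (trans sum₂ (sym (*-identityˡ n)))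
  n+L₂+L₃≡3n : n + sum L₂ + sum L₃ ≡ 3 * n
  n+L₂+L₃≡3n = trans (cong₂ _+_ n+L₂≡2n sum₃) (+-comm (2 * n) n)

GoodBlocks-straddled : ∀ {n} P₁ c₁ P₂ c₂ P₃ →
  let a₁ = sum P₁ ; a₂ = a₁ + c₁ + sum P₂ in
  a₁ ≤ n → GoodBlock n a₁ c₁ → n ≤ a₁ + c₁ →
  a₂ ≤ 2 * n → GoodBlock n a₂ c₂ → 2 * n ≤ a₂ + c₂ →
  a₂ + c₂ + sum P₃ ≤ 3 * n →
  GoodBlocks n 0 (P₁ ++ c₁ ∷ P₂ ++ c₂ ∷ P₃)
GoodBlocks-straddled {n} P₁ c₁ P₂ c₂ P₃ a₁≤n good₁ n≤a₁+c₁ a₂≤2n good₂ 2n≤a₂+c₂ end≤3n =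
  GoodBlocks-++ P₁ (GoodBlocks-inPart 0 P₁ z≤n (subst (sum P₁ ≤_) (sym (*-identityˡ n)) a₁≤n))
    (good₁ , GoodBlocks-++ P₂ (GoodBlocks-inPart 1 P₂ (subst (_≤ sum P₁ + c₁) (sym (*-identityˡ n)) n≤a₁+c₁) a₂≤2n)
      (good₂ , GoodBlocks-inPart 2 P₃ 2n≤a₂+c₂ end≤3n))

sum-replicate : ∀ k b → sum (replicate k b) ≡ k * b
sum-replicate zero    b = refl
sum-replicate (suc k) b = cong (b +_) (sum-replicate k b)

Partitionable : ℕ → ℕ → ℕ → Set
Partitionable s t N = s * t ≤ N × N ≤ suc s * t

balancedBlocks : ∀ s t N → Partitionable s t N → ∃[ L ] length L ≡ t × sum L ≡ N × All (Balanced s) L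
balancedBlocks s t N (st≤N , N≤t+st)
  with x , st+x≡N ← m≤n⇒∃[o]m+o≡n st≤N
  with y , x+y≡t  ← m≤n⇒∃[o]m+o≡n (+-cancelʳ-≤ (s * t) x t (subst (_≤ t + s * t) (trans (sym st+x≡N) (+-comm (s * t) x)) N≤t+st))
  = replicate x (suc s) ++ replicate y s , length≡ , sum≡ , balanced
  where
  open ≡-Reasoning
  length≡ : length (replicate x (suc s) ++ replicate y s) ≡ t
  length≡ = begin
    length (replicate x (suc s) ++ replicate y s)         ≡⟨ length-++ (replicate x (suc s)) ⟩
    length (replicate x (suc s)) + length (replicate y s) ≡⟨ cong₂ _+_ (length-replicate x) (length-replicate y) ⟩
    x + y                                                 ≡⟨ x+y≡t ⟩
    t                                                     ∎
  regroup : ∀ x y s → x * suc s + y * s ≡ s * (x + y) + x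
  regroup = solve-∀
  sum≡ : sum (replicate x (suc s) ++ replicate y s) ≡ N
  sum≡ = begin
    sum (replicate x (suc s) ++ replicate y s)      ≡⟨ sum-++ (replicate x (suc s)) (replicate y s) ⟩
    sum (replicate x (suc s)) + sum (replicate y s) ≡⟨ cong₂ _+_ (sum-replicate x (suc s)) (sum-replicate y s) ⟩
    x * suc s + y * s                               ≡⟨ regroup x y s ⟩
    s * (x + y) + x                                 ≡⟨ cong (λ z → s * z + x) x+y≡t ⟩
    s * t + x                                       ≡⟨ st+x≡N ⟩
    N                                               ∎
  balanced : All (Balanced s) (replicate x (suc s) ++ replicate y s)
  balanced = All.++⁺ (All.replicate⁺ x (n≤1+n s , ≤-refl)) (All.replicate⁺ y (≤-refl , n≤1+n s))

prefixCut : ∀ S T L → All (_≤ 4) L → S ≤ T → T ≤ S + sum L →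
            ∃[ P ] ∃[ R ] L ≡ P ++ R × S + sum P ≤ T × T ≤ S + sum P + 3
prefixCut S T []      _           S≤T T≤S+0 =
  [] , [] , refl , subst (_≤ T) (sym (+-identityʳ S)) S≤T , ≤-trans T≤S+0 (m≤m+n _ 3)
prefixCut S T (b ∷ L) (b≤4 ∷ L≤4) S≤T T≤ with T <? S + b
... | yes T<S+b = [] , b ∷ L , refl , subst (_≤ T) (sym (+-identityʳ S)) S≤T , s≤s⁻¹ (begin-strict
    T               <⟨ T<S+b ⟩
    S + b           ≤⟨ +-monoʳ-≤ S b≤4 ⟩
    S + 4           ≡⟨ +-suc S 3 ⟩
    suc (S + 3)     ≡⟨ cong (λ x → suc (x + 3)) (+-identityʳ S) ⟨
    suc (S + 0 + 3) ∎)
  where open ≤-Reasoning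
... | no  T≮S+b
  with P , R , L≡ , lo , hi ← prefixCut (S + b) T L L≤4 (≮⇒≥ T≮S+b) (subst (T ≤_) (sym (+-assoc S b (sum L))) T≤)
  = b ∷ P , R , cong (b ∷_) L≡ , subst (_≤ T) (+-assoc S b (sum P)) lo , subst (λ x → T ≤ x + 3) (+-assoc S b (sum P)) hi

straddledArrangement : ∀ n R → 3 ≤ n → All (_≤ 4) R → sum R + 6 ≡ 3 * n →
                       ∃[ L ] L ↭ 3 ∷ 3 ∷ R × GoodBlocks n 0 L
straddledArrangement n R 3≤n R≤4 sum≡ with prefixCut 0 n R R≤4 z≤n n≤sumR
  where
  open ≤-Reasoning
  n≤sumR : n ≤ sum R
  n≤sumR = +-cancelʳ-≤ 6 n (sum R) (begin
    n + 6     ≤⟨ +-monoʳ-≤ n (*-monoʳ-≤ 2 3≤n) ⟩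
    3 * n     ≡⟨ sum≡ ⟨
    sum R + 6 ∎)
... | P₁ , R₁ , R≡P₁++R₁ , a₁≤n , n≤a₁+3
  with prefixCut (sum P₁ + 3) (2 * n) R₁ (All.++⁻ʳ P₁ (subst (All (_≤ 4)) R≡P₁++R₁ R≤4)) a₁+3≤2n 2n≤a₁+3+R₁
  where
  open ≤-Reasoning
  a₁ = sum P₁
  a₁+3≤2n : a₁ + 3 ≤ 2 * n
  a₁+3≤2n = begin
    a₁ + 3 ≤⟨ +-mono-≤ a₁≤n 3≤n ⟩
    n + n  ≡⟨ cong (n +_) (+-identityʳ n) ⟨
    2 * n  ∎
  regroup : ∀ a r → a + r + 6 ≡ a + 3 + r + 3
  regroup = solve-∀
  2n≤a₁+3+R₁ : 2 * n ≤ a₁ + 3 + sum R₁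
  2n≤a₁+3+R₁ = +-cancelʳ-≤ 3 (2 * n) _ (begin
    2 * n + 3           ≤⟨ +-monoʳ-≤ (2 * n) 3≤n ⟩
    2 * n + n           ≡⟨ +-comm (2 * n) n ⟩
    3 * n               ≡⟨ sum≡ ⟨
    sum R + 6           ≡⟨ cong (_+ 6) (trans (cong sum R≡P₁++R₁) (sum-++ P₁ R₁)) ⟩
    a₁ + sum R₁ + 6     ≡⟨ regroup a₁ (sum R₁) ⟩
    a₁ + 3 + sum R₁ + 3 ∎)
... | P₂ , P₃ , R₁≡P₂++P₃ , a₂≤2n , 2n≤a₂+3 = P₁ ++ 3 ∷ P₂ ++ 3 ∷ P₃ , arrangement , good
  where
  R≡ : R ≡ P₁ ++ P₂ ++ P₃
  R≡ = trans R≡P₁++R₁ (cong (P₁ ++_) R₁≡P₂++P₃)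
  arrangement : P₁ ++ 3 ∷ P₂ ++ 3 ∷ P₃ ↭ 3 ∷ 3 ∷ R
  arrangement = begin
    P₁ ++ 3 ∷ P₂ ++ 3 ∷ P₃ ↭⟨ ++⁺ˡ P₁ (prep 3 (shift 3 P₂ P₃)) ⟩
    P₁ ++ 3 ∷ 3 ∷ P₂ ++ P₃ ↭⟨ shift 3 P₁ (3 ∷ P₂ ++ P₃) ⟩
    3 ∷ P₁ ++ 3 ∷ P₂ ++ P₃ ↭⟨ prep 3 (shift 3 P₁ (P₂ ++ P₃)) ⟩
    3 ∷ 3 ∷ P₁ ++ P₂ ++ P₃ ≡⟨ cong (λ L → 3 ∷ 3 ∷ L) R≡ ⟨
    3 ∷ 3 ∷ R              ∎
    where open PermutationReasoning
  regroup : ∀ a b c → a + 3 + b + 3 + c ≡ a + (b + c) + 6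
  regroup = solve-∀
  end≡3n : sum P₁ + 3 + sum P₂ + 3 + sum P₃ ≡ 3 * n
  end≡3n = begin
    sum P₁ + 3 + sum P₂ + 3 + sum P₃ ≡⟨ regroup (sum P₁) (sum P₂) (sum P₃) ⟩
    sum P₁ + (sum P₂ + sum P₃) + 6   ≡⟨ cong (λ x → sum P₁ + x + 6) (sum-++ P₂ P₃) ⟨
    sum P₁ + sum (P₂ ++ P₃) + 6      ≡⟨ cong (_+ 6) (sum-++ P₁ (P₂ ++ P₃)) ⟨
    sum (P₁ ++ P₂ ++ P₃) + 6         ≡⟨ cong (λ L → sum L + 6) R≡ ⟨
    sum R + 6                        ≡⟨ sum≡ ⟩
    3 * n                            ∎
    where open ≡-Reasoning
  2≤n = ≤-trans (n≤1+n 2) 3≤n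
  good : GoodBlocks n 0 (P₁ ++ 3 ∷ P₂ ++ 3 ∷ P₃)
  good = GoodBlocks-straddled P₁ 3 P₂ 3 P₃ a₁≤n (GoodBlock-≤3 _ 2≤n ≤-refl) n≤a₁+3
           a₂≤2n (GoodBlock-≤3 _ 2≤n ≤-refl) 2n≤a₂+3 (≤-reflexive end≡3n)

-- The colorings, by the number of colors

coloring-partwise : ∀ n s t₁ t₂ t₃ → Partitionable s t₁ n → Partitionable s t₂ n → Partitionable s t₃ n →
                    HasEquitableTreeColoring (K n) (t₁ + t₂ + t₃) 3
coloring-partwise n s t₁ t₂ t₃ split₁ split₂ split₃ =
  let L₁ , length₁ , sum₁ , balanced₁ = balancedBlocks s t₁ n split₁
      L₂ , length₂ , sum₂ , balanced₂ = balancedBlocks s t₂ n split₂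
      L₃ , length₃ , sum₃ , balanced₃ = balancedBlocks s t₃ n split₃
  in subst (λ t → HasEquitableTreeColoring (K n) t 3) (length≡ L₁ L₂ L₃ length₁ length₂ length₃)
       (goodBlocks⇒equitableTreeColoring (L₁ ++ L₂ ++ L₃) (sum≡ L₁ L₂ L₃ sum₁ sum₂ sum₃)
         (All.++⁺ balanced₁ (All.++⁺ balanced₂ balanced₃)) (GoodBlocks-partwise L₁ L₂ L₃ sum₁ sum₂ sum₃))
  where
  open ≡-Reasoning
  length≡ : ∀ L₁ L₂ L₃ → length L₁ ≡ t₁ → length L₂ ≡ t₂ → length L₃ ≡ t₃ → length (L₁ ++ L₂ ++ L₃) ≡ t₁ + t₂ + t₃
  length≡ L₁ L₂ L₃ refl refl refl = begin
    length (L₁ ++ L₂ ++ L₃)             ≡⟨ length-++ L₁ ⟩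
    length L₁ + length (L₂ ++ L₃)       ≡⟨ cong (length L₁ +_) (length-++ L₂) ⟩
    length L₁ + (length L₂ + length L₃) ≡⟨ +-assoc (length L₁) _ _ ⟨
    length L₁ + length L₂ + length L₃   ∎
  sum≡ : ∀ L₁ L₂ L₃ → sum L₁ ≡ n → sum L₂ ≡ n → sum L₃ ≡ n → sum (L₁ ++ L₂ ++ L₃) ≡ 3 * n
  sum≡ L₁ L₂ L₃ sum₁ sum₂ sum₃ = begin
    sum (L₁ ++ L₂ ++ L₃)       ≡⟨ sum-++ L₁ (L₂ ++ L₃) ⟩
    sum L₁ + sum (L₂ ++ L₃)    ≡⟨ cong (sum L₁ +_) (sum-++ L₂ L₃) ⟩
    sum L₁ + (sum L₂ + sum L₃) ≡⟨ cong₂ (λ a b → a + (b + sum L₃)) sum₁ sum₂ ⟩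
    n + (n + sum L₃)           ≡⟨ cong (λ c → n + (n + c)) (trans sum₃ (sym (+-identityʳ n))) ⟩
    3 * n                      ∎

thirds-sum : ∀ t → t / 3 + suc t / 3 + suc (suc t) / 3 ≡ t
thirds-sum zero    = refl
thirds-sum (suc t) = begin
  suc t / 3 + suc (suc t) / 3 + (3 + t) / 3 ≡⟨ cong (suc t / 3 + suc (suc t) / 3 +_) (m/n≡1+[m∸n]/n {3 + t} {3} (s≤s (s≤s (s≤s z≤n)))) ⟩
  suc t / 3 + suc (suc t) / 3 + suc (t / 3) ≡⟨ regroup (t / 3) (suc t / 3) (suc (suc t) / 3) ⟩
  suc (t / 3 + suc t / 3 + suc (suc t) / 3) ≡⟨ cong suc (thirds-sum t) ⟩
  suc t                                     ∎
  where
  open ≡-Reasoning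
  regroup : ∀ a b c → b + c + suc a ≡ suc (a + b + c)
  regroup = solve-∀

4k+2≤5[k∸m] : ∀ {k m} → 5 * m + 2 ≤ k → 4 * k + 2 ≤ 5 * (k ∸ m)
4k+2≤5[k∸m] {k} {m} 5m+2≤k = begin
  4 * k + 2           ≡⟨ cong (λ k → 4 * k + 2) d+m≡k ⟨
  4 * (d + m) + 2     ≡⟨ regroup₁ d m ⟩
  4 * d + (4 * m + 2) ≤⟨ +-monoʳ-≤ (4 * d) 4m+2≤d ⟩
  4 * d + d           ≡⟨ regroup₂ d ⟩
  5 * d               ∎
  where
  open ≤-Reasoning
  d = k ∸ m
  d+m≡k : d + m ≡ k
  d+m≡k = m∸n+n≡m (≤-trans (m≤n*m m 5) (≤-trans (m≤m+n (5 * m) 2) 5m+2≤k))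
  regroup₁ : ∀ d m → 4 * (d + m) + 2 ≡ 4 * d + (4 * m + 2)
  regroup₁ = solve-∀
  regroup₂ : ∀ d → 4 * d + d ≡ 5 * d
  regroup₂ = solve-∀
  regroup₃ : ∀ m → 4 * m + 2 + m ≡ 5 * m + 2
  regroup₃ = solve-∀
  4m+2≤d : 4 * m + 2 ≤ d
  4m+2≤d = +-cancelʳ-≤ m (4 * m + 2) d (begin
    4 * m + 2 + m ≡⟨ regroup₃ m ⟩
    5 * m + 2     ≤⟨ 5m+2≤k ⟩
    k             ≡⟨ d+m≡k ⟨
    d + m         ∎)

coloring-≤3k : ∀ k m t → 5 * m + 2 ≤ k → 3 * k ∸ 3 * m ≤ t → t ≤ 3 * k →
               HasEquitableTreeColoring (K (4 * k + 2)) t 3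
coloring-≤3k k m t 5m+2≤k lo hi =
  subst (λ t → HasEquitableTreeColoring (K (4 * k + 2)) t 3) (thirds-sum t)
    (coloring-partwise (4 * k + 2) 4 (t / 3) (suc t / 3) (suc (suc t) / 3) (fits 0 z≤n) (fits 1 (s≤s z≤n)) (fits 2 ≤-refl))
  where
  open ≤-Reasoning
  fits : ∀ i → i ≤ 2 → Partitionable 4 ((i + t) / 3) (4 * k + 2)
  fits i i≤2 = ≤-trans (*-monoʳ-≤ 4 x≤k) (m≤m+n (4 * k) 2) , ≤-trans (4k+2≤5[k∸m] {k} {m} 5m+2≤k) (*-monoʳ-≤ 5 k∸m≤x)
    where
    x = (i + t) / 3
    x≤k : x ≤ k
    x≤k = s≤s⁻¹ (*-cancelˡ-< 3 x (suc k) (begin-strict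
      3 * x     ≡⟨ *-comm 3 x ⟩
      x * 3     ≤⟨ m/n*n≤m (i + t) 3 ⟩
      i + t     ≤⟨ +-mono-≤ i≤2 hi ⟩
      2 + 3 * k <⟨ ≤-refl ⟩
      3 + 3 * k ≡⟨ *-suc 3 k ⟨
      3 * suc k ∎))
    k∸m≤x : k ∸ m ≤ x
    k∸m≤x = s≤s⁻¹ (*-cancelˡ-< 3 (k ∸ m) (suc x) (begin-strict
      3 * (k ∸ m)         ≡⟨ *-distribˡ-∸ 3 k m ⟩
      3 * k ∸ 3 * m       ≤⟨ lo ⟩
      t                   ≤⟨ m≤n+m t i ⟩
      i + t               ≡⟨ m≡m%n+[m/n]*n (i + t) 3 ⟩
      (i + t) % 3 + x * 3 <⟨ +-monoˡ-< (x * 3) (m%n<n (i + t) 3) ⟩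
      3 + x * 3           ≡⟨ cong (3 +_) (*-comm x 3) ⟩
      3 + 3 * x           ≡⟨ *-suc 3 x ⟨
      3 * suc x           ∎))

≤-offset : ∀ {a b} c → a + c ≡ b → a ≤ b
≤-offset c refl = m≤m+n _ c

-- The blocks 5, 4, …, 4 fill all of part 0 but its last vertex, which is the center of a
-- 4-star reaching into part 1; symmetrically a 4-star with center the first vertex of part 2
-- closes part 1.
twoStarsArrangement : ∀ Q n → sum Q + 6 ≡ n →
  GoodBlocks n 0 ((5 ∷ Q) ++ 4 ∷ Q ++ 4 ∷ 5 ∷ Q) × sum ((5 ∷ Q) ++ 4 ∷ Q ++ 4 ∷ 5 ∷ Q) ≡ 3 * n
twoStarsArrangement Q _ refl =
  GoodBlocks-straddled (5 ∷ Q) 4 Q 4 (5 ∷ Q)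
    (≤-offset 1 (e₁ q)) (leadingStar 1 (e₂ q) (≤-offset (q + 3) (e₃ q)) ≤-refl) (≤-offset 3 (e₄ q))
    (≤-offset 3 (e₅ q)) (trailingStar 1 (≤-offset (q + 3) (e₆ q)) (e₇ q) ≤-refl) (≤-offset 1 (e₈ q))
    (≤-reflexive (e₉ q))
  , (begin
    sum ((5 ∷ Q) ++ 4 ∷ Q ++ 4 ∷ 5 ∷ Q) ≡⟨ sum-++ (5 ∷ Q) (4 ∷ Q ++ 4 ∷ 5 ∷ Q) ⟩
    5 + q + (4 + sum (Q ++ 4 ∷ 5 ∷ Q))  ≡⟨ cong (λ x → 5 + q + (4 + x)) (sum-++ Q (4 ∷ 5 ∷ Q)) ⟩
    5 + q + (4 + (q + (4 + (5 + q))))   ≡⟨ e₁₀ q ⟩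
    3 * (q + 6)                         ∎)
  where
  open ≡-Reasoning
  q = sum Q
  e₁ : ∀ q → 5 + q + 1 ≡ q + 6
  e₁ = solve-∀
  e₂ : ∀ q → suc (5 + q) ≡ 1 * (q + 6)
  e₂ = solve-∀
  e₃ : ∀ q → 5 + q + 4 + (q + 3) ≡ 2 * (q + 6)
  e₃ = solve-∀
  e₄ : ∀ q → q + 6 + 3 ≡ 5 + q + 4
  e₄ = solve-∀
  e₅ : ∀ q → 5 + q + 4 + q + 3 ≡ 2 * (q + 6)
  e₅ = solve-∀
  e₆ : ∀ q → 1 * (q + 6) + (q + 3) ≡ 5 + q + 4 + q
  e₆ = solve-∀
  e₇ : ∀ q → 5 + q + 4 + q + 4 ≡ suc (2 * (q + 6))
  e₇ = solve-∀
  e₈ : ∀ q → 2 * (q + 6) + 1 ≡ 5 + q + 4 + q + 4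
  e₈ = solve-∀
  e₉ : ∀ q → 5 + q + 4 + q + 4 + (5 + q) ≡ 3 * (q + 6)
  e₉ = solve-∀
  e₁₀ : ∀ q → 5 + q + (4 + (q + (4 + (5 + q)))) ≡ 3 * (q + 6)
  e₁₀ = solve-∀

coloring-3k+1 : ∀ k → 1 ≤ k → HasEquitableTreeColoring (K (4 * k + 2)) (suc (3 * k)) 3
coloring-3k+1 k@(suc x) _ =
  let good , sum≡ = twoStarsArrangement Q n Q+6≡n
  in subst (λ t → HasEquitableTreeColoring (K n) t 3) length≡ (goodBlocks⇒equitableTreeColoring L sum≡ balanced good)
  where
  open ≡-Reasoning
  n = 4 * k + 2
  Q = replicate x 4
  L = (5 ∷ Q) ++ 4 ∷ Q ++ 4 ∷ 5 ∷ Q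
  regroup₁ : ∀ x → x * 4 + 6 ≡ 4 * suc x + 2
  regroup₁ = solve-∀
  Q+6≡n : sum Q + 6 ≡ n
  Q+6≡n = trans (cong (_+ 6) (sum-replicate x 4)) (regroup₁ x)
  four : Balanced 4 4
  four = ≤-refl , n≤1+n 4
  five : Balanced 4 5
  five = n≤1+n 4 , ≤-refl
  balanced : All (Balanced 4) L
  balanced = All.++⁺ (five ∷ fours) (four ∷ All.++⁺ fours (four ∷ five ∷ fours))
    where fours = All.replicate⁺ x four
  regroup₂ : ∀ x → suc x + suc (x + suc (suc x)) ≡ suc (3 * suc x)
  regroup₂ = solve-∀
  length≡ : length L ≡ suc (3 * k)
  length≡ = begin
    length L                                               ≡⟨ length-++ (5 ∷ Q) ⟩
    suc (length Q) + suc (length (Q ++ 4 ∷ 5 ∷ Q))         ≡⟨ cong (λ y → suc (length Q) + suc y) (length-++ Q) ⟩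
    suc (length Q) + suc (length Q + suc (suc (length Q))) ≡⟨ cong (λ y → suc y + suc (y + suc (suc y))) (length-replicate x) ⟩
    suc x + suc (x + suc (suc x))                          ≡⟨ regroup₂ x ⟩
    suc (3 * k)                                            ∎

coloring-≤4k+2 : ∀ k t → 1 ≤ k → 2 + 3 * k ≤ t → t ≤ 2 + 4 * k → HasEquitableTreeColoring (K (4 * k + 2)) t 3
coloring-≤4k+2 k (suc (suc u)) 1≤k (s≤s (s≤s 3k≤u)) (s≤s (s≤s u≤4k)) =
  let R , length≡u , sum≡ , balanced = balancedBlocks 3 u (12 * k) (3u≤12k , 12k≤4u)
      L , L↭ , good = straddledArrangement n R 3≤n (All.map proj₂ balanced) (sum+6≡3n R sum≡)
  in subst (λ t → HasEquitableTreeColoring (K n) t 3) (trans (↭-length L↭) (cong (2 +_) length≡u))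
       (goodBlocks⇒equitableTreeColoring L (trans (sum-↭ L↭) (trans (+-comm 6 (sum R)) (sum+6≡3n R sum≡)))
         (All-resp-↭ (↭-sym L↭) (three ∷ three ∷ balanced)) good)
  where
  n = 4 * k + 2
  3≤n : 3 ≤ n
  3≤n = ≤-trans (n≤1+n 3) (≤-trans (*-monoʳ-≤ 4 1≤k) (m≤m+n (4 * k) 2))
  3u≤12k : 3 * u ≤ 12 * k
  3u≤12k = subst (3 * u ≤_) (sym (*-assoc 3 4 k)) (*-monoʳ-≤ 3 u≤4k)
  12k≤4u : 12 * k ≤ 4 * u
  12k≤4u = subst (_≤ 4 * u) (sym (*-assoc 4 3 k)) (*-monoʳ-≤ 4 3k≤u)
  regroup : ∀ k → 12 * k + 6 ≡ 3 * (4 * k + 2)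
  regroup = solve-∀
  sum+6≡3n : ∀ R → sum R ≡ 12 * k → sum R + 6 ≡ 3 * n
  sum+6≡3n R sum≡ = trans (cong (_+ 6) sum≡) (regroup k)
  three : Balanced 3 3
  three = ≤-refl , n≤1+n 3

coloring->n : ∀ n t → 2 ≤ n → n < t → HasEquitableTreeColoring (K n) t 3
coloring->n n t@(suc _) 2≤n n<t =
  let L , length≡t , sum≡ , balanced = balancedBlocks s t (3 * n) (m/n*n≤m (3 * n) t , 3n≤t+st)
  in subst (λ t → HasEquitableTreeColoring (K n) t 3) length≡t
       (goodBlocks⇒equitableTreeColoring L sum≡ balanced
         (GoodBlocks-≤3 0 L 2≤n (All.map (λ (_ , b≤1+s) → ≤-trans b≤1+s s<3) balanced)))
  where
  s = 3 * n / t
  s<3 : s < 3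
  s<3 = m<n*o⇒m/o<n (*-monoʳ-< 3 n<t)
  3n≤t+st : 3 * n ≤ t + s * t
  3n≤t+st = begin
    3 * n             ≡⟨ m≡m%n+[m/n]*n (3 * n) t ⟩
    3 * n % t + s * t ≤⟨ +-monoˡ-≤ (s * t) (<⇒≤ (m%n<n (3 * n) t)) ⟩
    t + s * t         ∎
    where open ≤-Reasoning

proposition4 : (k m : ℕ) → 1 ≤ k → k ≥ 5 * m + 2 →
    StrongEquitableVertexArboricity≤ (completeTripartite (4 * k + 2)) 3 (3 * k ∸ 3 * m)
proposition4 k m 1≤k 5m+2≤k = 3 * k ∸ 3 * m , ≤-refl , colorable
  where
  colorable : ∀ t → t ≥ 3 * k ∸ 3 * m → HasEquitableTreeColoring (K (4 * k + 2)) t 3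
  colorable t t≥ with t ≤? 3 * k
  ... | yes t≤3k = coloring-≤3k k m t 5m+2≤k t≥ t≤3k
  ... | no  t≰3k with t ≟ suc (3 * k)
  ...   | yes refl = coloring-3k+1 k 1≤k
  ...   | no  t≢3k+1 with t ≤? 2 + 4 * k
  ...     | yes t≤n = coloring-≤4k+2 k t 1≤k (≤∧≢⇒< (≰⇒> t≰3k) (t≢3k+1 ∘ sym)) t≤n
  ...     | no  t≰n = coloring->n (4 * k + 2) t (m≤n+m 2 (4 * k)) (subst (_< t) (+-comm 2 (4 * k)) (≰⇒> t≰n))
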